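{- Let $T$ be a tableau and $x,y$ distinct elements not among the labels of $T$. Assume that the column trail of $x\to T$ and the row trail of $T\leftarrow y$ have a (necessarily unique) common box $S$ which is a box of $T$, and let $\ell$ be the row of $S$. Compare the row trail of $T\leftarrow y$ with the row trail of $(x\to T)\leftarrow y$ (labels of the former taken in $T$, labels of the latter taken in $x\to T$). Then: (i) the parts of these two row trails lying in rows $1,\dots,\ell-1$ are equal (same boxes, in the same order, with the same labels); (ii) if the box of the two trails lying in row $\ell+1$ is the same box with the same label for both trails, then the parts of the two trails lying in rows $\ell+1,\ell+2,\dots$ are equal.
   Context: Tableaux use the French convention: a tableau $T$ is a finite lower order ideal $D$ (componentwise order) of boxes $(c,r)\in\{1,2,\dots\}^2$ ($c$ = column, $r$ = row, row $1$ at the bottom), with an injective labelling by a totally ordered set, strictly increasing to the right along rows and upward along columns. Row insertion of $x$ into a row $L$ ($x\notin L$): if $L$ is empty or $x>\max L$, append $x$; otherwise replace the smallest $z\in L$ with $z>x$ by $x$, and $z$ is bumped. $T\leftarrow x$ inserts $x$ into row $1$, then the bumped element into row $2$, etc., until nothing is bumped (the last element occupies a new box at the end of its row). Column insertion $x\to T$ is defined symmetrically with columns (column $1$ leftmost). The row trail of $T\leftarrow x$ is the sequence of boxes of $T$ whose labels are bumped, in order, each with its label in $T$, followed by the newly created box (the empty box of the trail, unlabelled). The column trail of $x\to T$ is defined symmetrically. A row trail has at most one box in each row, and its consecutive boxes lie in consecutive rows starting from row $1$. -}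

module Defs where

open import Level using (Level)
open import Data.Nat as Nat using (ℕ; zero; suc)
open import Data.List using (List; []; _∷_; length; concat; map; filter)
open import Data.List.Membership.Propositional using (_∈_; _∉_)
open import Data.List.Relation.Unary.Unique.Propositional using (Unique)
open import Data.Maybe using (Maybe; just; nothing)
open import Data.Product using (_×_; _,_; proj₁; proj₂; ∃)
open import Relation.Binary.Core using (Rel)
open import Relation.Binary.Definitions using (Decidable)
open import Relation.Binary.PropositionalEquality using (_≡_; _≢_)
open import Relation.Nullary using (yes; no)

-- A tableau is represented by its list of rows, row 1 (bottom) first; each row is
-- the list of its labels from left to right (column 1 first).
module Tab {a ℓ : Level} (A : Set a) (_<_ : Rel A ℓ) (_<?_ : Decidable _<_) where

  Lines : Set a
  Lines = List (List A)

  -- Boxes (c , r): c = column, r = row, both 1-based.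
  Box : Set
  Box = ℕ × ℕ

  col row : Box → ℕ
  col = proj₁
  row = proj₂

  at : {B : Set a} → List B → ℕ → Maybe B
  at []       _       = nothing
  at (b ∷ bs) zero    = just b
  at (b ∷ bs) (suc n) = at bs n

  label : Lines → Box → Maybe A
  label T (suc c , suc r) with at T r
  ... | just L  = at L c
  ... | nothing = nothing
  label T _ = nothing

  InT : Lines → Box → Set a
  InT T S = ∃ λ v → label T S ≡ just v

  labels : Lines → List A
  labels = concat

  record IsTableau (T : Lines) : Set (a Level.⊔ ℓ) where
    field
      rowsNonempty : ∀ r L → at T r ≡ just L → L ≢ []
      lowerIdeal   : ∀ c r v → label T (c , suc (suc r)) ≡ just v → InT T (c , suc r)
      rowIncr      : ∀ c r u v → label T (c , r) ≡ just u → label T (suc c , r) ≡ just v → u < v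
      colIncr      : ∀ c r u v → label T (c , r) ≡ just u → label T (c , suc r) ≡ just v → u < v
      injective    : Unique (labels T)

  -- Insertion of an element into a single line (row, or column read bottom-up).
  -- Returns the new line and, if something is bumped, its 0-based position and label.
  insLine : A → List A → List A × Maybe (ℕ × A)
  insLine x [] = x ∷ [] , nothing
  insLine x (z ∷ zs) with x <? z
  ... | yes _ = x ∷ zs , just (0 , z)
  ... | no  _ with insLine x zs
  ...   | zs' , nothing      = z ∷ zs' , nothing
  ...   | zs' , just (j , w) = z ∷ zs' , just (suc j , w)

  -- Raw trail entries: (0-based line index, 0-based position in line, label or
  -- nothing for the newly created box).
  RawEntry : Set a
  RawEntry = ℕ × ℕ × Maybe A

  insLines : ℕ → A → Lines → Lines × List RawEntry
  insLines i x [] = (x ∷ []) ∷ [] , (i , 0 , nothing) ∷ []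
  insLines i x (L ∷ Ls) with insLine x L
  ... | L' , nothing = L' ∷ Ls , (i , length L , nothing) ∷ []
  ... | L' , just (j , z) with insLines (suc i) z Ls
  ...   | Ls' , tr = L' ∷ Ls' , (i , j , just z) ∷ tr

  addLine : List A → Lines → Lines
  addLine [] cs = cs
  addLine (v ∷ vs) [] = (v ∷ []) ∷ addLine vs []
  addLine (v ∷ vs) (c ∷ cs) = (v ∷ c) ∷ addLine vs cs

  transpose : Lines → Lines
  transpose [] = []
  transpose (L ∷ Ls) = addLine L (transpose Ls)

  -- A trail entry: a box together with its label (nothing = the new, empty box).
  Entry : Set a
  Entry = Box × Maybe A

  entryRow : Entry → ℕ
  entryRow e = row (proj₁ e)

  toRowEntry : RawEntry → Entry
  toRowEntry (i , j , l) = (suc j , suc i) , l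

  toColEntry : RawEntry → Entry
  toColEntry (i , j , l) = (suc i , suc j) , l

  rowInsert : Lines → A → Lines
  rowInsert T y = proj₁ (insLines 0 y T)

  rowTrail : Lines → A → List Entry
  rowTrail T y = map toRowEntry (proj₂ (insLines 0 y T))

  colInsert : A → Lines → Lines
  colInsert x T = transpose (proj₁ (insLines 0 x (transpose T)))

  colTrail : A → Lines → List Entry
  colTrail x T = map toColEntry (proj₂ (insLines 0 x (transpose T)))

  trailBoxes : List Entry → List Box
  trailBoxes = map proj₁

  below : ℕ → List Entry → List Entry
  below ℓ' = filter (λ e → entryRow e Nat.<? ℓ')

  above : ℕ → List Entry → List Entry
  above ℓ' = filter (λ e → ℓ' Nat.<? entryRow e)

-- Column insertion of x changes T only along its column trail, which moves weakly down as it
-- moves right and carries increasing labels; the row trail of y moves weakly left as it moves up,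
-- also with increasing labels. Both pass through S, with label s, in row ℓ. Below row ℓ the
-- column trail lies right of S, so the cells it changes hold labels above s, while the row trail
-- there only inspects cells up to a bumped label below s: it meets no changed cell. Above row ℓ
-- the column trail lies left of S, so a changed cell receives a label smaller than its old one,
-- which was below s, while the row trail there bumps labels above s; so every row is bumped at
-- the same place as before. Hence the row trails agree below row ℓ, and once they agree in row
-- ℓ + 1 they insert the same label into row ℓ + 2 and agree from then on.

module Submission where

open import Defs
open import Level using (Level; _⊔_)
open import Data.Nat as Nat using (ℕ; zero; suc; _≤_; z≤n; s≤s)
open import Data.Nat.Properties as NatP using ()
open import Data.List using (List; []; _∷_; length; map; drop)
open import Data.List.Properties using (filter-accept; filter-reject)
open import Data.List.Membership.Propositional using (_∈_; _∉_)
open import Data.List.Membership.Propositional.Properties using (∈-map⁻)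
open import Data.List.Relation.Unary.Any using (here; there)
open import Data.Maybe as Maybe using (Maybe; just; nothing; fromMaybe; _>>=_)
open import Data.Maybe.Properties using (just-injective)
open import Data.Product using (_×_; _,_; proj₁; proj₂; ∃; map₁)
open import Data.Sum using (_⊎_; inj₁; inj₂)
open import Data.Empty using (⊥-elim)
open import Relation.Binary.Core using (Rel)
open import Relation.Binary.Definitions using (Decidable)
open import Relation.Binary.Structures using (IsStrictTotalOrder)
open import Relation.Binary.PropositionalEquality
open import Relation.Nullary using (yes; no; ¬_)
open import Function using (_∘′_)

module Bumping {a ℓ : Level} {A : Set a} {_<_ : Rel A ℓ} (_<?_ : Decidable _<_) where

  open Tab A _<_ _<?_

  -- Where a label lands in a line, and what it displaces there (nothing: a new box).
  Bump : Set a
  Bump = ℕ × Maybe A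

  bump : A → List A → Bump
  bump v [] = 0 , nothing
  bump v (z ∷ zs) with v <? z
  ... | yes _ = 0 , just z
  ... | no  _ = map₁ suc (bump v zs)

  insert : A → List A → List A
  insert v [] = v ∷ []
  insert v (z ∷ zs) with v <? z
  ... | yes _ = v ∷ zs
  ... | no  _ = z ∷ insert v zs

  bumpOut : Bump → Maybe (ℕ × A)
  bumpOut (j , o) = Maybe.map (j ,_) o

  insLine-≡ : ∀ v L → insLine v L ≡ (insert v L , bumpOut (bump v L))
  insLine-≡ v [] = refl
  insLine-≡ v (z ∷ zs) with v <? z
  ... | yes _ = refl
  ... | no  _ rewrite insLine-≡ v zs with bump v zs
  ...   | p , nothing = refl
  ...   | p , just w  = refl

  bump-new : ∀ v L → proj₂ (bump v L) ≡ nothing → proj₁ (bump v L) ≡ length L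
  bump-new v [] _ = refl
  bump-new v (z ∷ zs) e with v <? z
  bump-new v (z ∷ zs) () | yes _
  ... | no _ = cong suc (bump-new v zs e)

  IsBump : A → List A → Bump → Set (a ⊔ ℓ)
  IsBump v L (p , o) = (∀ q → q Nat.< p → ∃ λ w → at L q ≡ just w × ¬ v < w)
                     × at L p ≡ o
                     × (∀ z → o ≡ just z → v < z)

  bump-isBump : ∀ v L → IsBump v L (bump v L)
  bump-isBump v [] = (λ q ()) , refl , (λ z ())
  bump-isBump v (z ∷ zs) with v <? z
  ... | yes v<z = (λ q ()) , refl , (λ { _ refl → v<z })
  ... | no  v≮z with bump v zs | bump-isBump v zs
  ...   | p , o | smaller , hit , larger =
          (λ { zero _ → z , refl , v≮z ; (suc q) (s≤s q<p) → smaller q q<p }) , hit , larger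

  bump≡⇒isBump : ∀ v L {b} → bump v L ≡ b → IsBump v L b
  bump≡⇒isBump v L refl = bump-isBump v L

  bump-hit : ∀ v L → at L (proj₁ (bump v L)) ≡ proj₂ (bump v L)
  bump-hit v L = proj₁ (proj₂ (bump-isBump v L))

  bump-displaces-larger : ∀ v L {p z} → bump v L ≡ (p , just z) → v < z
  bump-displaces-larger v L b = proj₂ (proj₂ (bump≡⇒isBump v L b)) _ refl

  isBump⇒≡bump : ∀ v L b → IsBump v L b → bump v L ≡ b
  isBump⇒≡bump v [] (zero , o) (_ , hit , _) = cong (0 ,_) hit
  isBump⇒≡bump v [] (suc p , o) (smaller , _) with () ← proj₁ (proj₂ (smaller 0 (s≤s z≤n)))
  isBump⇒≡bump v (z ∷ zs) (p , o) (smaller , hit , larger) with v <? z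
  isBump⇒≡bump v (z ∷ zs) (zero , o) (_ , hit , _) | yes _ = cong (0 ,_) hit
  isBump⇒≡bump v (z ∷ zs) (suc p , o) (smaller , _) | yes v<z with smaller 0 (s≤s z≤n)
  ... | _ , refl , v≮z = ⊥-elim (v≮z v<z)
  isBump⇒≡bump v (z ∷ zs) (zero , o) (_ , refl , larger) | no v≮z = ⊥-elim (v≮z (larger z refl))
  isBump⇒≡bump v (z ∷ zs) (suc p , o) (smaller , hit , larger) | no _ =
    cong (map₁ suc) (isBump⇒≡bump v zs (p , o) ((λ q q<p → smaller (suc q) (s≤s q<p)) , hit , larger))

  bump-stable : ∀ v L L′ → let p = proj₁ (bump v L) in
                (∀ q → q ≤ p → at L′ q ≡ at L q ⊎ (q Nat.< p × ∃ λ w → at L′ q ≡ just w × ¬ v < w))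
                → bump v L′ ≡ bump v L
  bump-stable v L L′ agree with bump-isBump v L
  ... | smaller , hit , larger = isBump⇒≡bump v L′ (bump v L) (smaller′ , hit′ , larger)
    where
      smaller′ : ∀ q → q Nat.< proj₁ (bump v L) → ∃ λ w → at L′ q ≡ just w × ¬ v < w
      smaller′ q q<p with agree q (NatP.<⇒≤ q<p)
      ... | inj₁ same   = subst (λ m → ∃ λ w → m ≡ just w × ¬ v < w) (sym same) (smaller q q<p)
      ... | inj₂ (_ , r) = r
      hit′ : at L′ (proj₁ (bump v L)) ≡ proj₂ (bump v L)
      hit′ with agree (proj₁ (bump v L)) NatP.≤-refl
      ... | inj₁ same      = trans same hit
      ... | inj₂ (p<p , _) = ⊥-elim (NatP.<-irrefl refl p<p)

  bump-leftmost : ∀ v L {q t} → q ≤ proj₁ (bump v L) → at L q ≡ just t → v < t → q ≡ proj₁ (bump v L)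
  bump-leftmost v L {q} q≤p e v<t with q Nat.≟ proj₁ (bump v L)
  ... | yes q≡p = q≡p
  ... | no  q≢p with proj₁ (bump-isBump v L) q (NatP.≤∧≢⇒< q≤p q≢p)
  ...   | w , e′ , v≮w = ⊥-elim (v≮w (subst (v <_) (just-injective (trans (sym e) e′)) v<t))

  at-prefix : ∀ (L : List A) {p w} q → at L p ≡ just w → q ≤ p → ∃ λ w′ → at L q ≡ just w′
  at-prefix (z ∷ zs) zero _ _ = z , refl
  at-prefix (z ∷ zs) {suc p} (suc q) e (s≤s q≤p) = at-prefix zs q e q≤p

  insert-at-bump : ∀ v L → at (insert v L) (proj₁ (bump v L)) ≡ just v
  insert-at-bump v [] = refl
  insert-at-bump v (z ∷ zs) with v <? z
  ... | yes _ = refl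
  ... | no  _ = insert-at-bump v zs

  insert-at-other : ∀ v L q → q ≢ proj₁ (bump v L) → at (insert v L) q ≡ at L q
  insert-at-other v [] zero q≢p = ⊥-elim (q≢p refl)
  insert-at-other v [] (suc q) _ = refl
  insert-at-other v (z ∷ zs) q q≢p with v <? z
  insert-at-other v (z ∷ zs) zero q≢p    | yes _ = ⊥-elim (q≢p refl)
  insert-at-other v (z ∷ zs) (suc q) _   | yes _ = refl
  insert-at-other v (z ∷ zs) zero _      | no  _ = refl
  insert-at-other v (z ∷ zs) (suc q) q≢p | no  _ = insert-at-other v zs q (q≢p ∘′ cong suc)

  line : Lines → ℕ → List A
  line Ls k = fromMaybe [] (at Ls k)

  line-suc : ∀ Ls k → line Ls (suc k) ≡ line (drop 1 Ls) k
  line-suc []       k = refl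
  line-suc (L ∷ Ls) k = refl

  -- A line is a row of a tableau or, after transposition, a column. Lines and positions are
  -- 0-based, whereas boxes (column, row) are 1-based.
  cell : Lines → ℕ → ℕ → Maybe A
  cell Ls k q = at (line Ls k) q

  label≡cell : ∀ T c r → label T (suc c , suc r) ≡ cell T r c
  label≡cell T c r with at T r
  ... | just L  = refl
  ... | nothing = refl

  _∷?_ : Maybe A → List A → List A
  nothing ∷? vs = vs
  just v  ∷? vs = v ∷ vs

  line-addLine : ∀ L N j → line (addLine L N) j ≡ at L j ∷? line N j
  line-addLine []       N        j       = refl
  line-addLine (v ∷ vs) []       zero    = refl
  line-addLine (v ∷ vs) []       (suc j) with at vs j | line-addLine vs [] j
  ... | nothing | e = e
  ... | just _  | e = e
  line-addLine (v ∷ vs) (c ∷ cs) zero    = refl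
  line-addLine (v ∷ vs) (c ∷ cs) (suc j) = line-addLine vs cs j

  LowerIdeal : Lines → Set a
  LowerIdeal M = ∀ i j w → cell M (suc i) j ≡ just w → ∃ λ w′ → cell M i j ≡ just w′

  lowerIdeal-empty : ∀ M → LowerIdeal M → ∀ j → cell M 0 j ≡ nothing → ∀ i → cell M i j ≡ nothing
  lowerIdeal-empty M li j e zero = e
  lowerIdeal-empty M li j e (suc i) with cell M (suc i) j in e′
  ... | nothing = refl
  ... | just w with li i j w e′
  ...   | w′ , e″ with () ← trans (sym e″) (lowerIdeal-empty M li j e i)

  cell-transpose : ∀ M → LowerIdeal M → ∀ i j → cell (transpose M) j i ≡ cell M i j
  cell-transpose [] li i j = refl
  cell-transpose (L ∷ Ls) li i j rewrite line-addLine L (transpose Ls) j with at L j in e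
  cell-transpose (L ∷ Ls) li zero    j | just v = sym e
  cell-transpose (L ∷ Ls) li (suc i) j | just v = cell-transpose Ls (λ i → li (suc i)) i j
  ... | nothing = begin
    cell (transpose Ls) j i   ≡⟨ cell-transpose Ls (λ i → li (suc i)) i j ⟩
    cell (L ∷ Ls) (suc i) j   ≡⟨ lowerIdeal-empty (L ∷ Ls) li j e (suc i) ⟩
    nothing                   ≡⟨ lowerIdeal-empty (L ∷ Ls) li j e i ⟨
    cell (L ∷ Ls) i j         ∎
    where open ≡-Reasoning

  -- Inserting into successive lines

  inserted : A → Lines → ℕ → Maybe A
  inserted u Ls zero    = just u
  inserted u Ls (suc k) = proj₂ (bump u (line Ls 0)) >>= λ z → inserted z (drop 1 Ls) k

  trailAt : A → Lines → ℕ → Maybe Bump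
  trailAt u Ls k = Maybe.map (λ v → bump v (line Ls k)) (inserted u Ls k)

  mutual
    trail : ℕ → A → Lines → List RawEntry
    trail i u []       = (i , 0 , nothing) ∷ []
    trail i u (L ∷ Ls) = trailFrom i (bump u L) Ls

    trailFrom : ℕ → Bump → Lines → List RawEntry
    trailFrom i (j , nothing) Ls = (i , j , nothing) ∷ []
    trailFrom i (j , just z)  Ls = (i , j , just z) ∷ trail (suc i) z Ls

  mutual
    insertAll : A → Lines → Lines
    insertAll u []       = (u ∷ []) ∷ []
    insertAll u (L ∷ Ls) = insert u L ∷ insertFrom (proj₂ (bump u L)) Ls

    insertFrom : Maybe A → Lines → Lines
    insertFrom nothing  Ls = Ls
    insertFrom (just z) Ls = insertAll z Ls

  trail-unfold : ∀ i u Ls → trail i u Ls ≡ trailFrom i (bump u (line Ls 0)) (drop 1 Ls)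
  trail-unfold i u []       = refl
  trail-unfold i u (L ∷ Ls) = refl

  insLines-≡ : ∀ i u Ls → insLines i u Ls ≡ (insertAll u Ls , trail i u Ls)
  insLines-≡ i u [] = refl
  insLines-≡ i u (L ∷ Ls) rewrite insLine-≡ u L with bump u L in e
  ... | j , nothing = cong (λ n → insert u L ∷ Ls , (i , n , nothing) ∷ []) (sym j≡length)
    where j≡length : j ≡ length L
          j≡length = trans (cong proj₁ (sym e)) (bump-new u L (cong proj₂ e))
  ... | j , just z rewrite insLines-≡ (suc i) z Ls = refl

  inserted-suc : ∀ u Ls k → inserted u Ls (suc k) ≡ (trailAt u Ls k >>= proj₂)
  inserted-suc u Ls zero with proj₂ (bump u (line Ls 0))
  ... | nothing = refl
  ... | just z  = refl
  inserted-suc u Ls (suc k) with proj₂ (bump u (line Ls 0))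
  ... | nothing = refl
  ... | just z rewrite inserted-suc z (drop 1 Ls) k | line-suc Ls k = refl

  trailAt-suc : ∀ u Ls {z} k → proj₂ (bump u (line Ls 0)) ≡ just z
              → trailAt u Ls (suc k) ≡ trailAt z (drop 1 Ls) k
  trailAt-suc u Ls k e rewrite line-suc Ls k | e = refl

  trailAt-stop : ∀ u Ls k → proj₂ (bump u (line Ls 0)) ≡ nothing → trailAt u Ls (suc k) ≡ nothing
  trailAt-stop u Ls k e rewrite e = refl

  ∈trail⇒trailAt : ∀ i u Ls r → r ∈ trail i u Ls
                 → ∃ λ k → proj₁ r ≡ i Nat.+ k × trailAt u Ls k ≡ just (proj₂ r)
  ∈trail⇒trailAt i u [] r (here refl) = 0 , sym (NatP.+-identityʳ i) , refl
  ∈trail⇒trailAt i u (L ∷ Ls) r m with bump u L in e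
  ∈trail⇒trailAt i u (L ∷ Ls) r (here refl) | j , nothing = 0 , sym (NatP.+-identityʳ i) , cong just e
  ∈trail⇒trailAt i u (L ∷ Ls) r (here refl) | j , just z  = 0 , sym (NatP.+-identityʳ i) , cong just e
  ∈trail⇒trailAt i u (L ∷ Ls) r (there m)   | j , just z with ∈trail⇒trailAt (suc i) z Ls r m
  ... | k , r≡ , e′ =
    suc k , trans r≡ (sym (NatP.+-suc i k)) , trans (trailAt-suc u (L ∷ Ls) k (cong proj₂ e)) e′

  trailAt⇒inserted : ∀ u Ls k {b} → trailAt u Ls k ≡ just b
                   → ∃ λ v → inserted u Ls k ≡ just v × bump v (line Ls k) ≡ b
  trailAt⇒inserted u Ls k e with inserted u Ls k
  trailAt⇒inserted u Ls k refl | just v = v , refl , refl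

  inserted⇒trailAt : ∀ u Ls k {v} → inserted u Ls k ≡ just v → trailAt u Ls k ≡ just (bump v (line Ls k))
  inserted⇒trailAt u Ls k e rewrite e = refl

  trailAt⇒inserted-suc : ∀ u Ls k {p z} → trailAt u Ls k ≡ just (p , just z) → inserted u Ls (suc k) ≡ just z
  trailAt⇒inserted-suc u Ls k e rewrite inserted-suc u Ls k | e = refl

  inserted-suc⇒trailAt : ∀ u Ls k {z} → inserted u Ls (suc k) ≡ just z
                       → ∃ λ p → trailAt u Ls k ≡ just (p , just z)
  inserted-suc⇒trailAt u Ls k e rewrite inserted-suc u Ls k with trailAt u Ls k
  ... | just (p , just _) = p , cong (λ o → just (p , o)) e

  Changed : A → Lines → ℕ → ℕ → Set a
  Changed u Ls k q = ∃ λ v → inserted u Ls k ≡ just v × proj₁ (bump v (line Ls k)) ≡ q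
                            × cell (insertAll u Ls) k q ≡ just v

  cell-insertAll : ∀ u Ls k q → cell (insertAll u Ls) k q ≡ cell Ls k q ⊎ Changed u Ls k q
  cell-insertAll u [] zero    zero    = inj₂ (u , refl , refl , refl)
  cell-insertAll u [] zero    (suc q) = inj₁ refl
  cell-insertAll u [] (suc k) q       = inj₁ refl
  cell-insertAll u (L ∷ Ls) zero q with q Nat.≟ proj₁ (bump u L)
  ... | yes refl = inj₂ (u , refl , refl , insert-at-bump u L)
  ... | no  q≢p  = inj₁ (insert-at-other u L q q≢p)
  cell-insertAll u (L ∷ Ls) (suc k) q with proj₂ (bump u L)
  ... | nothing = inj₁ refl
  ... | just z  = cell-insertAll z Ls k q

  trailAt-hit : ∀ u Ls k {p o} → trailAt u Ls k ≡ just (p , o) → cell Ls k p ≡ o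
  trailAt-hit u Ls k e with trailAt⇒inserted u Ls k e
  ... | v , _ , b = proj₁ (proj₂ (bump≡⇒isBump v (line Ls k) b))

  ∈map-trail⇒trailAt : ∀ {b} {B : Set b} (f : RawEntry → B) u Ls {y} → y ∈ map f (trail 0 u Ls)
                     → ∃ λ k → ∃ λ p → ∃ λ o → y ≡ f (k , p , o) × trailAt u Ls k ≡ just (p , o)
  ∈map-trail⇒trailAt f u Ls m with ∈-map⁻ f m
  ... | (_ , p , o) , m′ , refl with ∈trail⇒trailAt 0 u Ls _ m′
  ...   | k , refl , e = k , p , o , refl , e

  SameBumps : A → Lines → Lines → ℕ → Set a
  SameBumps u Ls Ls′ k = ∀ v → inserted u Ls k ≡ just v → bump v (line Ls′ k) ≡ bump v (line Ls k)

  trailAt-agree : ∀ u Ls Ls′ k → inserted u Ls k ≡ inserted u Ls′ k → SameBumps u Ls Ls′ k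
                → trailAt u Ls k ≡ trailAt u Ls′ k × inserted u Ls (suc k) ≡ inserted u Ls′ (suc k)
  trailAt-agree u Ls Ls′ k e same rewrite inserted-suc u Ls k | inserted-suc u Ls′ k with inserted u Ls k
  ... | nothing rewrite sym e = refl , refl
  ... | just v  rewrite sym e | same v refl = refl , refl

  inserted-agree-upto : ∀ u Ls Ls′ {m} → (∀ k → k Nat.< m → SameBumps u Ls Ls′ k)
                      → ∀ k → k ≤ m → inserted u Ls k ≡ inserted u Ls′ k
  inserted-agree-upto u Ls Ls′ same zero    _   = refl
  inserted-agree-upto u Ls Ls′ same (suc k) k<m =
    proj₂ (trailAt-agree u Ls Ls′ k (inserted-agree-upto u Ls Ls′ same k (NatP.<⇒≤ k<m)) (same k k<m))

  inserted-agree-from : ∀ u Ls Ls′ {k₀} → inserted u Ls k₀ ≡ inserted u Ls′ k₀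
                      → (∀ k → k₀ ≤ k → SameBumps u Ls Ls′ k)
                      → ∀ k → k₀ ≤ k → inserted u Ls k ≡ inserted u Ls′ k
  inserted-agree-from u Ls Ls′ e same zero z≤n = e
  inserted-agree-from u Ls Ls′ e same (suc k) k₀≤ with NatP.m≤n⇒m<n∨m≡n k₀≤
  ... | inj₂ refl        = e
  ... | inj₁ (s≤s k₀≤k) =
    proj₂ (trailAt-agree u Ls Ls′ k (inserted-agree-from u Ls Ls′ e same k k₀≤k) (same k k₀≤k))

  -- Parts of trails below and above a row

  rowEntries : List RawEntry → List Entry
  rowEntries = map toRowEntry

  trail-cong : ∀ i u u′ Ls Ls′ → (∀ k → trailAt u Ls k ≡ trailAt u′ Ls′ k)
             → trail i u Ls ≡ trail i u′ Ls′
  trail-cong i u u′ [] Ls′ agree rewrite trail-unfold i u′ Ls′ | sym (just-injective (agree 0)) = refl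
  trail-cong i u u′ (L ∷ Ls) Ls′ agree rewrite trail-unfold i u′ Ls′ | sym (just-injective (agree 0))
    with bump u L in e
  ... | j , nothing = refl
  ... | j , just z  = cong ((i , j , just z) ∷_) (trail-cong (suc i) z z Ls (drop 1 Ls′) agree′)
    where
      agree′ : ∀ k → trailAt z Ls k ≡ trailAt z (drop 1 Ls′) k
      agree′ k = begin
        trailAt z Ls k              ≡⟨ trailAt-suc u (L ∷ Ls) k (cong proj₂ e) ⟨
        trailAt u (L ∷ Ls) (suc k)  ≡⟨ agree (suc k) ⟩
        trailAt u′ Ls′ (suc k)      ≡⟨ trailAt-suc u′ Ls′ k (cong proj₂ (trans (sym first) e)) ⟩
        trailAt z (drop 1 Ls′) k    ∎
        where
          open ≡-Reasoning
          first : bump u L ≡ bump u′ (line Ls′ 0)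
          first = just-injective (agree 0)

  below-skip : ∀ {ℓ′ r rs} → ¬ entryRow r Nat.< ℓ′ → below ℓ′ (r ∷ rs) ≡ below ℓ′ rs
  below-skip {ℓ′} = filter-reject (λ e → entryRow e Nat.<? ℓ′)

  below-keep : ∀ {ℓ′ r rs} → entryRow r Nat.< ℓ′ → below ℓ′ (r ∷ rs) ≡ r ∷ below ℓ′ rs
  below-keep {ℓ′} = filter-accept (λ e → entryRow e Nat.<? ℓ′)

  below-trail-late : ∀ ℓ′ i u Ls → ¬ suc i Nat.< ℓ′ → below ℓ′ (rowEntries (trail i u Ls)) ≡ []
  below-trail-late ℓ′ i u [] late = below-skip late
  below-trail-late ℓ′ i u (L ∷ Ls) late with bump u L
  ... | j , nothing = below-skip late
  ... | j , just z  = trans (below-skip late)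
                            (below-trail-late ℓ′ (suc i) z Ls (late ∘′ NatP.<-trans (NatP.n<1+n _)))

  below-trail-cong : ∀ ℓ′ i u Ls Ls′
                   → (∀ k → suc (k Nat.+ i) Nat.< ℓ′ → trailAt u Ls k ≡ trailAt u Ls′ k)
                   → below ℓ′ (rowEntries (trail i u Ls)) ≡ below ℓ′ (rowEntries (trail i u Ls′))
  below-trail-cong ℓ′ i u Ls Ls′ agree with suc i Nat.<? ℓ′
  ... | no late = trans (below-trail-late ℓ′ i u Ls late) (sym (below-trail-late ℓ′ i u Ls′ late))
  below-trail-cong ℓ′ i u [] Ls′ agree | yes early
    rewrite trail-unfold i u Ls′ | sym (just-injective (agree 0 early)) = refl
  below-trail-cong ℓ′ i u (L ∷ Ls) Ls′ agree | yes early
    rewrite trail-unfold i u Ls′ | sym (just-injective (agree 0 early)) with bump u L in e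
  ... | j , nothing = refl
  ... | j , just z  =
    trans (below-keep early)
          (trans (cong (toRowEntry (i , j , just z) ∷_)
                       (below-trail-cong ℓ′ (suc i) z Ls (drop 1 Ls′) agree′))
                 (sym (below-keep early)))
    where
      agree′ : ∀ k → suc (k Nat.+ suc i) Nat.< ℓ′ → trailAt z Ls k ≡ trailAt z (drop 1 Ls′) k
      agree′ k lt = begin
        trailAt z Ls k              ≡⟨ trailAt-suc u (L ∷ Ls) k (cong proj₂ e) ⟨
        trailAt u (L ∷ Ls) (suc k)  ≡⟨ agree (suc k) (subst (λ n → suc n Nat.< ℓ′) (NatP.+-suc k i) lt) ⟩
        trailAt u Ls′ (suc k)       ≡⟨ trailAt-suc u Ls′ k (cong proj₂ (trans (sym first) e)) ⟩
        trailAt z (drop 1 Ls′) k    ∎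
        where
          open ≡-Reasoning
          first : bump u L ≡ bump u (line Ls′ 0)
          first = just-injective (agree 0 early)

  ≤-+-suc : ∀ {m} k i → m ≤ k Nat.+ suc i → m ≤ suc k Nat.+ i
  ≤-+-suc {m} k i = subst (m ≤_) (NatP.+-suc k i)

  above-skip : ∀ {ℓ′ r rs} → ¬ ℓ′ Nat.< entryRow r → above ℓ′ (r ∷ rs) ≡ above ℓ′ rs
  above-skip {ℓ′} = filter-reject (λ e → ℓ′ Nat.<? entryRow e)

  above-trail-stop : ∀ ℓ′ i u Ls → (∀ k → ℓ′ ≤ k Nat.+ i → trailAt u Ls k ≡ nothing)
                   → above ℓ′ (rowEntries (trail i u Ls)) ≡ []
  above-trail-stop ℓ′ i u Ls none with ℓ′ Nat.<? suc i
  ... | yes ℓ′≤i with () ← none 0 (NatP.≤-pred ℓ′≤i)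
  above-trail-stop ℓ′ i u [] none | no early = above-skip early
  above-trail-stop ℓ′ i u (L ∷ Ls) none | no early with bump u L in e
  ... | j , nothing = above-skip early
  ... | j , just z  = trans (above-skip early)
                            (above-trail-stop ℓ′ (suc i) z Ls none′)
    where
      none′ : ∀ k → ℓ′ ≤ k Nat.+ suc i → trailAt z Ls k ≡ nothing
      none′ k le = trans (sym (trailAt-suc u (L ∷ Ls) k (cong proj₂ e))) (none (suc k) (≤-+-suc k i le))

  above-trail-cong : ∀ ℓ′ i u u′ Ls Ls′
                   → (∀ k → ℓ′ ≤ k Nat.+ i → trailAt u Ls k ≡ trailAt u′ Ls′ k)
                   → above ℓ′ (rowEntries (trail i u Ls)) ≡ above ℓ′ (rowEntries (trail i u′ Ls′))
  above-trail-cong ℓ′ i u u′ Ls Ls′ agree with ℓ′ Nat.<? suc i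
  ... | yes ℓ′≤i = cong (above ℓ′ ∘′ rowEntries)
                     (trail-cong i u u′ Ls Ls′ λ k →
                        agree k (NatP.≤-trans (NatP.≤-pred ℓ′≤i) (NatP.m≤n+m i k)))
  above-trail-cong ℓ′ i u u′ [] Ls′ agree | no early =
    trans (above-skip early) (sym (above-trail-stop ℓ′ i u′ Ls′ none))
    where
      none : ∀ k → ℓ′ ≤ k Nat.+ i → trailAt u′ Ls′ k ≡ nothing
      none zero    ℓ′≤i = ⊥-elim (early (s≤s ℓ′≤i))
      none (suc k) le   = sym (agree (suc k) le)
  above-trail-cong ℓ′ i u u′ (L ∷ Ls) Ls′ agree | no early rewrite trail-unfold i u′ Ls′
    with bump u L in e | bump u′ (line Ls′ 0) in e′
  ... | j , nothing | j′ , nothing = trans (above-skip early) (sym (above-skip early))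
  ... | j , nothing | j′ , just z′ =
    trans (above-skip early) (sym (trans (above-skip early) (above-trail-stop ℓ′ (suc i) z′ (drop 1 Ls′)
      λ k le →
      trans (sym (trailAt-suc u′ Ls′ k (cong proj₂ e′)))
            (trans (sym (agree (suc k) (≤-+-suc k i le))) (trailAt-stop u (L ∷ Ls) k (cong proj₂ e))))))
  ... | j , just z  | j′ , nothing =
    trans (trans (above-skip early) (above-trail-stop ℓ′ (suc i) z Ls λ k le →
      trans (sym (trailAt-suc u (L ∷ Ls) k (cong proj₂ e)))
            (trans (agree (suc k) (≤-+-suc k i le)) (trailAt-stop u′ Ls′ k (cong proj₂ e′)))))
          (sym (above-skip early))
  ... | j , just z  | j′ , just z′ =
    trans (above-skip early) (trans (above-trail-cong ℓ′ (suc i) z z′ Ls (drop 1 Ls′) λ k le →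
      trans (sym (trailAt-suc u (L ∷ Ls) k (cong proj₂ e)))
            (trans (agree (suc k) (≤-+-suc k i le)) (trailAt-suc u′ Ls′ k (cong proj₂ e′))))
      (sym (above-skip early)))

  ∈trailBoxes⇒trailAt : ∀ (f : RawEntry → Entry) u Ls {S}
                      → S ∈ trailBoxes (map f (proj₂ (insLines 0 u Ls)))
                      → ∃ λ k → ∃ λ p → ∃ λ o → S ≡ proj₁ (f (k , p , o)) × trailAt u Ls k ≡ just (p , o)
  ∈trailBoxes⇒trailAt f u Ls m rewrite insLines-≡ 0 u Ls with ∈-map⁻ proj₁ m
  ... | _ , m′ , refl with ∈map-trail⇒trailAt f u Ls m′
  ...   | k , p , o , refl , e = k , p , o , refl , e

  shared-rowEntry : ∀ u Ls Ls′ {e k} → e ∈ rowEntries (trail 0 u Ls) → e ∈ rowEntries (trail 0 u Ls′)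
                  → entryRow e ≡ suc k → trailAt u Ls k ≡ trailAt u Ls′ k
  shared-rowEntry u Ls Ls′ e∈ e∈′ row≡
    with ∈map-trail⇒trailAt toRowEntry u Ls e∈ | ∈map-trail⇒trailAt toRowEntry u Ls′ e∈′
  ... | _ , _ , _ , refl , h | _ , _ , _ , refl , h′ with row≡
  ...   | refl = trans h (sym h′)

module Trails {a ℓ : Level} {A : Set a} {_<_ : Rel A ℓ} (sto : IsStrictTotalOrder _≡_ _<_) where

  open IsStrictTotalOrder sto using (_<?_) renaming (trans to <-trans)
  open Tab A _<_ _<?_
  open Bumping _<?_

  <-irrefl : ∀ {v} → ¬ v < v
  <-irrefl = IsStrictTotalOrder.irrefl sto refl

  inserted-increasing : ∀ u Ls {k k′ v w} → inserted u Ls k ≡ just v → inserted u Ls k′ ≡ just w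
                      → k Nat.< k′ → v < w
  inserted-increasing u Ls {k′ = suc k′} ev ew (s≤s k≤k′) with inserted-suc⇒trailAt u Ls k′ ew
  ... | _ , ep with trailAt⇒inserted u Ls k′ ep
  ...   | v′ , ev′ , b with NatP.m≤n⇒m<n∨m≡n k≤k′
  ...     | inj₁ k<k′ =
              <-trans (inserted-increasing u Ls ev ev′ k<k′) (bump-displaces-larger v′ (line Ls k′) b)
  ...     | inj₂ refl with trans (sym ev) ev′
  ...       | refl = bump-displaces-larger v′ (line Ls k′) b

  trailAt-increasing : ∀ u Ls {k k′ p p′ z z′}
                     → trailAt u Ls k ≡ just (p , just z) → trailAt u Ls k′ ≡ just (p′ , just z′)
                     → k Nat.< k′ → z < z′
  trailAt-increasing u Ls {k} {k′} e e′ k<k′ =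
    inserted-increasing u Ls (trailAt⇒inserted-suc u Ls k e) (trailAt⇒inserted-suc u Ls k′ e′) (s≤s k<k′)

  trailAt-before : ∀ u Ls {k k′ v} → inserted u Ls k′ ≡ just v → k Nat.< k′
                 → ∃ λ p → ∃ λ z → trailAt u Ls k ≡ just (p , just z)
  trailAt-before u Ls {k′ = suc k′} e (s≤s k≤k′) with inserted-suc⇒trailAt u Ls k′ e
  ... | p , ep with NatP.m≤n⇒m<n∨m≡n k≤k′
  ...   | inj₂ refl = p , _ , ep
  ...   | inj₁ k<k′ = trailAt-before u Ls (proj₁ (proj₂ (trailAt⇒inserted u Ls k′ ep))) k<k′

  module ColumnInsertion (T : Lines) (tab : IsTableau T) (x : A) where

    open IsTableau tab

    rows-increasing : ∀ r c {u v} → cell T r c ≡ just u → cell T r (suc c) ≡ just v → u < v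
    rows-increasing r c e e′ =
      rowIncr (suc c) (suc r) _ _ (trans (label≡cell T c r) e) (trans (label≡cell T (suc c) r) e′)

    lowerIdeal-T : LowerIdeal T
    lowerIdeal-T i j w e with lowerIdeal (suc j) i w (trans (label≡cell T j (suc i)) e)
    ... | w′ , e′ = w′ , trans (sym (label≡cell T j i)) e′

    Cs : Lines
    Cs = transpose T

    cell-Cs : ∀ c r → cell Cs c r ≡ cell T r c
    cell-Cs c r = cell-transpose T lowerIdeal-T r c

    lowerIdeal-Cs : LowerIdeal Cs
    lowerIdeal-Cs i j w e with at-prefix (line T j) i (trans (sym (cell-Cs (suc i) j)) e) (NatP.n≤1+n i)
    ... | w′ , e′ = w′ , trans (cell-Cs i j) e′

    Cs′ : Lines
    Cs′ = insertAll x Cs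

    cell-Cs′-kept : ∀ {i j w} → cell Cs i j ≡ just w → ∃ λ w′ → cell Cs′ i j ≡ just w′
    cell-Cs′-kept {i} {j} {w} e with cell-insertAll x Cs i j
    ... | inj₁ same = w , trans same e
    ... | inj₂ (v , _ , _ , e′) = v , e′

    -- A new box at the end of column i + 1 sits at a height reached by column i, since it
    -- receives the label bumped from column i and rows increase.
    lowerIdeal-Cs′ : LowerIdeal Cs′
    lowerIdeal-Cs′ i j w e with cell-insertAll x Cs (suc i) j
    ... | inj₁ same = cell-Cs′-kept (proj₂ (lowerIdeal-Cs i j w (trans (sym same) e)))
    ... | inj₂ (v , ev , refl , _) with proj₂ (bump v (line Cs (suc i))) in displaced
    ...   | just z =
            cell-Cs′-kept (proj₂ (lowerIdeal-Cs i j z (trans (bump-hit v (line Cs (suc i))) displaced)))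
    ...   | nothing with inserted-suc⇒trailAt x Cs i ev
    ...     | p₀ , e₀ with j Nat.≤? p₀
    ...       | yes j≤p₀ = cell-Cs′-kept (proj₂ (at-prefix (line Cs i) j (trailAt-hit x Cs i e₀) j≤p₀))
    ...       | no  j≰p₀ with proj₁ (bump-isBump v (line Cs (suc i))) p₀ (NatP.≰⇒> j≰p₀)
    ...         | w′ , e′ , v≮w′ =
                  ⊥-elim (v≮w′ (rows-increasing p₀ i (trans (sym (cell-Cs i p₀)) (trailAt-hit x Cs i e₀))
                                                      (trans (sym (cell-Cs (suc i) p₀)) e′)))

    T′ : Lines
    T′ = transpose Cs′

    cell-T′≡ : ∀ k q → cell T′ k q ≡ cell Cs′ q k
    cell-T′≡ k q = cell-transpose Cs′ lowerIdeal-Cs′ q k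

    cell-T′ : ∀ k q → cell T′ k q ≡ cell T k q ⊎ Changed x Cs q k
    cell-T′ k q with cell-insertAll x Cs q k
    ... | inj₁ same = inj₁ (trans (cell-T′≡ k q) (trans same (cell-Cs q k)))
    ... | inj₂ ch   = inj₂ ch

    changed⇒colTrailAt : ∀ {q k} → Changed x Cs q k → trailAt x Cs q ≡ just (k , cell T k q)
    changed⇒colTrailAt {q} {k} (w , ew , wk , _) = begin
      trailAt x Cs q                                     ≡⟨ inserted⇒trailAt x Cs q ew ⟩
      just (bump w (line Cs q))                          ≡⟨ cong (λ p → just (p , _)) wk ⟩
      just (k , proj₂ (bump w (line Cs q)))              ≡⟨ cong (just ∘′ (k ,_)) (bump-hit w (line Cs q)) ⟨
      just (k , cell Cs q (proj₁ (bump w (line Cs q))))  ≡⟨ cong (λ p → just (k , cell Cs q p)) wk ⟩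
      just (k , cell Cs q k)                             ≡⟨ cong (just ∘′ (k ,_)) (cell-Cs q k) ⟩
      just (k , cell T k q)                              ∎
      where open ≡-Reasoning

    -- Rows increase, so a label bumped out of column q lands in column q + 1 no higher up
    colTrail-descends-step : ∀ q {p t p′ o′} → trailAt x Cs q ≡ just (p , just t)
                           → trailAt x Cs (suc q) ≡ just (p′ , o′) → p′ ≤ p
    colTrail-descends-step q {p} {t} {p′} e e′ with p′ Nat.≤? p
    ... | yes p′≤p = p′≤p
    ... | no  p′≰p with trailAt⇒inserted x Cs (suc q) e′
    ...   | _ , et′ , b′ with trans (sym (trailAt⇒inserted-suc x Cs q e)) et′
    ...     | refl with proj₁ (bump≡⇒isBump t (line Cs (suc q)) b′) p (NatP.≰⇒> p′≰p)
    ...       | w , ew , t≮w =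
                  ⊥-elim (t≮w (rows-increasing p q (trans (sym (cell-Cs q p)) (trailAt-hit x Cs q e))
                                                   (trans (sym (cell-Cs (suc q) p)) ew)))

    colTrail-descends : ∀ q q′ {p p′ o o′} → trailAt x Cs q ≡ just (p , o)
                      → trailAt x Cs q′ ≡ just (p′ , o′) → q ≤ q′ → p′ ≤ p
    colTrail-descends q q′ e e′ q≤q′ with NatP.m≤n⇒m<n∨m≡n q≤q′
    colTrail-descends q q e e′ _ | inj₂ refl with trans (sym e) e′
    ... | refl = NatP.≤-refl
    colTrail-descends q (suc q″) e e′ _ | inj₁ (s≤s q≤q″)
      with inserted-suc⇒trailAt x Cs q″ (proj₁ (proj₂ (trailAt⇒inserted x Cs (suc q″) e′)))
    ... | _ , e″ = NatP.≤-trans (colTrail-descends-step q″ e″ e′) (colTrail-descends q q″ e e″ q≤q″)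

    module Crossing (y : A) (c₀ ℓ₀ : ℕ) (s : A)
                    (colCross : trailAt x Cs c₀ ≡ just (ℓ₀ , just s))
                    (rowCross : trailAt y T ℓ₀ ≡ just (c₀ , just s)) where

      colTrail-right-below : ∀ q {k o} → trailAt x Cs q ≡ just (k , o) → k Nat.< ℓ₀ → c₀ Nat.< q
      colTrail-right-below q colq k<ℓ₀ =
        NatP.≰⇒> λ q≤c₀ → NatP.<⇒≱ k<ℓ₀ (colTrail-descends q c₀ colq colCross q≤c₀)

      colTrail-left-above : ∀ q {k o} → trailAt x Cs q ≡ just (k , o) → ℓ₀ Nat.< k → q Nat.< c₀
      colTrail-left-above q colq ℓ₀<k =
        NatP.≰⇒> λ c₀≤q → NatP.<⇒≱ ℓ₀<k (colTrail-descends c₀ q colCross colq c₀≤q)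

      no-change-below : ∀ {k v q} → k Nat.< ℓ₀ → inserted y T k ≡ just v
                      → q ≤ proj₁ (bump v (line T k)) → ¬ Changed x Cs q k
      no-change-below {k} {v} {q} k<ℓ₀ ev q≤p ch
        with trailAt-before y T (proj₁ (proj₂ (trailAt⇒inserted y T ℓ₀ rowCross))) k<ℓ₀
      ... | _ , z , rowk with just-injective (trans (sym (inserted⇒trailAt y T k ev)) rowk)
      ... | bk with at-prefix (line T k) q (trans (bump-hit v (line T k)) (cong proj₂ bk)) q≤p
      ... | t , et = <-irrefl (<-trans z<s (subst (s <_) t≡z s<t))
        where
          colq : trailAt x Cs q ≡ just (k , just t)
          colq = trans (changed⇒colTrailAt ch) (cong (λ o → just (k , o)) et)
          s<t : s < t
          s<t = trailAt-increasing x Cs colCross colq (colTrail-right-below q colq k<ℓ₀)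
          z<s : z < s
          z<s = trailAt-increasing y T rowk rowCross k<ℓ₀
          v<z : v < z
          v<z = bump-displaces-larger v (line T k) bk
          q≡p : q ≡ proj₁ (bump v (line T k))
          q≡p = bump-leftmost v (line T k) q≤p et (<-trans v<z (<-trans z<s s<t))
          t≡z : t ≡ z
          t≡z = just-injective (begin
            just t                                       ≡⟨ et ⟨
            cell T k q                                   ≡⟨ cong (cell T k) q≡p ⟩
            cell T k (proj₁ (bump v (line T k)))         ≡⟨ bump-hit v (line T k) ⟩
            proj₂ (bump v (line T k))                    ≡⟨ cong proj₂ bk ⟩
            just z                                       ∎)
            where open ≡-Reasoning

      harmless-change-above : ∀ {k v q} → ℓ₀ Nat.< k → inserted y T k ≡ just v
                            → q ≤ proj₁ (bump v (line T k)) → Changed x Cs q k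
                            → q Nat.< proj₁ (bump v (line T k)) × ∃ λ w → cell T′ k q ≡ just w × ¬ v < w
      harmless-change-above {k} {v} {q} ℓ₀<k ev q≤p ch@(w , ew , _ , w∈Cs′)
        with trailAt-before x Cs (proj₁ (proj₂ (trailAt⇒inserted x Cs c₀ colCross)))
               (colTrail-left-above q (changed⇒colTrailAt ch) ℓ₀<k)
      ... | _ , t , colq = q<p , w , trans (cell-T′≡ k q) w∈Cs′ , λ v<w → v≮t (<-trans v<w w<t)
        where
          et : cell T k q ≡ just t
          et = cong proj₂ (just-injective (trans (sym (changed⇒colTrailAt ch)) colq))
          t<s : t < s
          t<s = trailAt-increasing x Cs colq colCross (colTrail-left-above q (changed⇒colTrailAt ch) ℓ₀<k)
          w<t : w < t
          w<t = bump-displaces-larger w (line Cs q)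
                  (just-injective (trans (sym (inserted⇒trailAt x Cs q ew)) colq))
          rowk : q ≡ proj₁ (bump v (line T k)) → trailAt y T k ≡ just (proj₁ (bump v (line T k)) , just t)
          rowk q≡p = trans (inserted⇒trailAt y T k ev)
                           (cong (λ o → just (proj₁ (bump v (line T k)) , o))
                                 (trans (sym (bump-hit v (line T k))) (trans (cong (cell T k) (sym q≡p)) et)))
          q<p : q Nat.< proj₁ (bump v (line T k))
          q<p = NatP.≤∧≢⇒< q≤p λ q≡p →
                  <-irrefl (<-trans t<s (trailAt-increasing y T rowCross (rowk q≡p) ℓ₀<k))
          v≮t : ¬ v < t
          v≮t v<t = NatP.<⇒≢ q<p (bump-leftmost v (line T k) q≤p et v<t)

      sameBumps-below : ∀ k → k Nat.< ℓ₀ → SameBumps y T T′ k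
      sameBumps-below k k<ℓ₀ v ev = bump-stable v (line T k) (line T′ k) (λ q → inj₁ ∘′ unchanged q)
        where
          unchanged : ∀ q → q ≤ proj₁ (bump v (line T k)) → cell T′ k q ≡ cell T k q
          unchanged q q≤p with cell-T′ k q
          ... | inj₁ same = same
          ... | inj₂ ch   = ⊥-elim (no-change-below k<ℓ₀ ev q≤p ch)

      sameBumps-above : ∀ k → ℓ₀ Nat.< k → SameBumps y T T′ k
      sameBumps-above k ℓ₀<k v ev = bump-stable v (line T k) (line T′ k) harmless
        where
          harmless : ∀ q → q ≤ proj₁ (bump v (line T k))
                   → cell T′ k q ≡ cell T k q
                     ⊎ (q Nat.< proj₁ (bump v (line T k)) × ∃ λ w → cell T′ k q ≡ just w × ¬ v < w)
          harmless q q≤p with cell-T′ k q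
          ... | inj₁ same = inj₁ same
          ... | inj₂ ch   = inj₂ (harmless-change-above ℓ₀<k ev q≤p ch)

      rowTrails-agree-below : below (suc ℓ₀) (rowEntries (trail 0 y T))
                            ≡ below (suc ℓ₀) (rowEntries (trail 0 y T′))
      rowTrails-agree-below = below-trail-cong (suc ℓ₀) 0 y T T′ agree
        where
          agree : ∀ k → suc (k Nat.+ 0) Nat.< suc ℓ₀ → trailAt y T k ≡ trailAt y T′ k
          agree k (s≤s k<ℓ₀) rewrite NatP.+-identityʳ k =
            proj₁ (trailAt-agree y T T′ k (inserted-agree-upto y T T′ sameBumps-below k (NatP.<⇒≤ k<ℓ₀))
                                          (sameBumps-below k k<ℓ₀))

      rowTrails-agree-above : trailAt y T (suc ℓ₀) ≡ trailAt y T′ (suc ℓ₀)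
                            → above (suc ℓ₀) (rowEntries (trail 0 y T))
                              ≡ above (suc ℓ₀) (rowEntries (trail 0 y T′))
      rowTrails-agree-above agreeNext = above-trail-cong (suc ℓ₀) 0 y y T T′ agree
        where
          insertedAfter : inserted y T (suc (suc ℓ₀)) ≡ inserted y T′ (suc (suc ℓ₀))
          insertedAfter = trans (inserted-suc y T (suc ℓ₀))
                                (trans (cong (_>>= proj₂) agreeNext) (sym (inserted-suc y T′ (suc ℓ₀))))
          sameBumps-after : ∀ k → suc (suc ℓ₀) ≤ k → SameBumps y T T′ k
          sameBumps-after k = sameBumps-above k ∘′ NatP.<-trans (NatP.n<1+n ℓ₀)
          agree : ∀ k → suc ℓ₀ ≤ k Nat.+ 0 → trailAt y T k ≡ trailAt y T′ k
          agree k le rewrite NatP.+-identityʳ k with NatP.m≤n⇒m<n∨m≡n le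
          ... | inj₂ refl = agreeNext
          ... | inj₁ ℓ₀+1<k =
            proj₁ (trailAt-agree y T T′ k (inserted-agree-from y T T′ insertedAfter sameBumps-after k ℓ₀+1<k)
                                          (sameBumps-after k ℓ₀+1<k))

    common-box : ∀ y S → S ∈ trailBoxes (colTrail x T) → S ∈ trailBoxes (rowTrail T y) → InT T S
               → ∃ λ c₀ → ∃ λ ℓ₀ → ∃ λ s → S ≡ (suc c₀ , suc ℓ₀)
                 × trailAt x Cs c₀ ≡ just (ℓ₀ , just s) × trailAt y T ℓ₀ ≡ just (c₀ , just s)
    common-box y S inCol inRow (s , S∈T)
      with ∈trailBoxes⇒trailAt toColEntry x Cs inCol | ∈trailBoxes⇒trailAt toRowEntry y T inRow
    ... | c₀ , ℓ₀ , o , refl , colCross | _ , _ , o′ , refl , rowCross =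
      c₀ , ℓ₀ , s , refl ,
      trans colCross (cong (λ o → just (ℓ₀ , o))
                           (trans (sym (trailAt-hit x Cs c₀ colCross)) (trans (cell-Cs c₀ ℓ₀) s∈T))) ,
      trans rowCross (cong (λ o → just (c₀ , o)) (trans (sym (trailAt-hit y T ℓ₀ rowCross)) s∈T))
      where
        s∈T : cell T ℓ₀ c₀ ≡ just s
        s∈T = trans (sym (label≡cell T c₀ ℓ₀)) S∈T

    rowTrail-colInsert : ∀ y S → S ∈ trailBoxes (colTrail x T) → S ∈ trailBoxes (rowTrail T y) → InT T S
      → (below (row S) (rowTrail T y) ≡ below (row S) (rowTrail (colInsert x T) y))
        × ((e : Entry) → e ∈ rowTrail T y → e ∈ rowTrail (colInsert x T) y → entryRow e ≡ suc (row S)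
           → above (row S) (rowTrail T y) ≡ above (row S) (rowTrail (colInsert x T) y))
    rowTrail-colInsert y S inCol inRow S∈T with common-box y S inCol inRow S∈T
    ... | c₀ , ℓ₀ , s , refl , colCross , rowCross
      rewrite insLines-≡ 0 x Cs | insLines-≡ 0 y T | insLines-≡ 0 y T′ =
      rowTrails-agree-below , λ e e∈ e∈′ e-row → rowTrails-agree-above (shared-rowEntry y T T′ e∈ e∈′ e-row)
      where open Crossing y c₀ ℓ₀ s colCross rowCross

lemma8 : ∀ {a ℓ : Level} (A : Set a) (_<_ : Rel A ℓ) (sto : IsStrictTotalOrder _≡_ _<_)
    → let open Tab A _<_ (IsStrictTotalOrder._<?_ sto) in
      (T : Lines) → IsTableau T
    → (x y : A) → x ≢ y → x ∉ labels T → y ∉ labels T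
    → (S : Box) → S ∈ trailBoxes (colTrail x T) → S ∈ trailBoxes (rowTrail T y) → InT T S
    → (below (row S) (rowTrail T y) ≡ below (row S) (rowTrail (colInsert x T) y))
      × ((e : Entry) → e ∈ rowTrail T y → e ∈ rowTrail (colInsert x T) y
         → entryRow e ≡ suc (row S)
         → above (row S) (rowTrail T y) ≡ above (row S) (rowTrail (colInsert x T) y))
lemma8 A _<_ sto T tab x y _ _ _ = Trails.ColumnInsertion.rowTrail-colInsert sto T tab x y
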